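{- Let $\Delta$ be a bi-transitive bipartite digraph with edge set $E$, and let $u,v$ be distinct vertices. Then $u$ is strongly connected to $v$ if and only if either $uv\in E$ (in which case $u,v$ have different colours), or there exists a vertex $w$ with $uw,wv\in E$ (in which case $u,v$ have the same colour).
   Context: Digraphs have no loops or multiple edges. A bipartite digraph has two colour classes with every edge joining different classes; it is bi-transitive if whenever $u_1v_1,v_1u_2,u_2v_2\in E$, also $u_1v_2\in E$. A vertex $x$ is strongly connected to $y$ if there is a directed walk $x=x_0\to x_1\to\cdots\to x_k=y$ with $k\ge1$ and each $x_ix_{i+1}\in E$. -}

module Defs where

open import Data.Bool using (Bool)
open import Data.Empty using (⊥)
open import Relation.Binary.PropositionalEquality using (_≡_; _≢_)

record Digraph : Set₁ where
  field
    V       : Set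
    E       : V → V → Set
    loopless : ∀ x → E x x → ⊥

record BipartiteDigraph : Set₁ where
  field
    digraph   : Digraph
  open Digraph digraph public
  field
    colour    : V → Bool
    bipartite : ∀ {x y} → E x y → colour x ≢ colour y

module _ (Δ : BipartiteDigraph) where
  open BipartiteDigraph Δ

  BiTransitive : Set
  BiTransitive = ∀ {u₁ v₁ u₂ v₂} → E u₁ v₁ → E v₁ u₂ → E u₂ v₂ → E u₁ v₂

  data Walk⁺ : V → V → Set where
    step : ∀ {x y} → E x y → Walk⁺ x y
    _∷_  : ∀ {x y z} → E x y → Walk⁺ y z → Walk⁺ x z

  StronglyConnectedTo : V → V → Set
  StronglyConnectedTo x y = Walk⁺ x y

-- Bi-transitivity contracts the first three edges of any walk into one, so every
-- walk shortens to a walk of length one or two; the colour condition is then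
-- forced by bipartiteness, since two steps across the bipartition return to
-- the same class.
module Submission where

open import Defs
open import Data.Bool using (Bool)
open import Data.Bool.Properties using (¬-not)
open import Data.Product using (Σ; _×_; _,_)
open import Data.Sum using (_⊎_; inj₁; inj₂)
open import Function.Bundles using (_⇔_; mk⇔)
open import Relation.Binary.PropositionalEquality using (_≡_; _≢_; sym; trans; ≢-sym)

≢-≢⇒≡ : {a b c : Bool} → a ≢ b → b ≢ c → a ≡ c
≢-≢⇒≡ a≢b b≢c = trans (¬-not a≢b) (sym (¬-not (≢-sym b≢c)))

module _ (Δ : BipartiteDigraph) where
  open BipartiteDigraph Δ

  TwoStep : V → V → Set
  TwoStep x y = Σ V (λ w → E x w × E w y)

  walk-shorten : BiTransitive Δ → ∀ {x y} → Walk⁺ Δ x y → E x y ⊎ TwoStep x y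
  walk-shorten bt (step xy)        = inj₁ xy
  walk-shorten bt (xw ∷ step wy)   = inj₂ (_ , xw , wy)
  walk-shorten bt (xa ∷ (ab ∷ bz)) with walk-shorten bt bz
  ... | inj₁ by            = inj₁ (bt xa ab by)
  ... | inj₂ (w , bw , wy) = inj₂ (w , bt xa ab bw , wy)

  twoStep-colour : ∀ {x w y} → E x w → E w y → colour x ≡ colour y
  twoStep-colour xw wy = ≢-≢⇒≡ (bipartite xw) (bipartite wy)

lemma10 : (Δ : BipartiteDigraph) → BiTransitive Δ →
    (u v : BipartiteDigraph.V Δ) → u ≢ v →
    StronglyConnectedTo Δ u v ⇔
    ((BipartiteDigraph.E Δ u v × BipartiteDigraph.colour Δ u ≢ BipartiteDigraph.colour Δ v)
    ⊎ Σ (BipartiteDigraph.V Δ) (λ w → BipartiteDigraph.E Δ u w × BipartiteDigraph.E Δ w v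
    × BipartiteDigraph.colour Δ u ≡ BipartiteDigraph.colour Δ v))
lemma10 Δ bt u v _ = mk⇔ to from
  where
  open BipartiteDigraph Δ

  to : Walk⁺ Δ u v →
       (E u v × colour u ≢ colour v) ⊎ Σ V (λ w → E u w × E w v × colour u ≡ colour v)
  to walk with walk-shorten Δ bt walk
  ... | inj₁ uv             = inj₁ (uv , bipartite uv)
  ... | inj₂ (w , uw , wv)  = inj₂ (w , uw , wv , twoStep-colour Δ uw wv)

  from : (E u v × colour u ≢ colour v) ⊎ Σ V (λ w → E u w × E w v × colour u ≡ colour v) →
         Walk⁺ Δ u v
  from (inj₁ (uv , _))          = step uv
  from (inj₂ (w , uw , wv , _)) = uw ∷ step wv
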